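{- For every $n\ge1$ there exists a non-adaptive set $\mathcal{Q}$ of $n^2+n$ query sequences, using only one extra character (a real number outside $\{0,1\}$) in addition to $0$ and $1$, and an algorithm that, for any input sequence $s\in\{0,1\}^{\ell}$ with $0\le\ell\le n$, exactly recovers $s$ from the values $d_{\mathrm{DTW}}(s,q)$, $q\in\mathcal{Q}$.
   Context: An expansion of a sequence $x$ is any sequence obtained from $x$ by replacing each character by one or more consecutive copies of itself. For sequences $x,y$ of real numbers, $d_{\mathrm{DTW}}(x,y)=\min\|\bar x-\bar y\|_1$ over all pairs $(\bar x,\bar y)$ of equal-length expansions. Non-adaptive: the queries are fixed independently of $s$; the length of $s$ is unknown. -}

module Defs where

open import Data.Bool using (Bool; true; false)
open import Data.List using (List; []; _∷_; length; map)
open import Data.Maybe using (Maybe; just; nothing)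
open import Data.Product using (Σ; _×_; _,_)
open import Data.Rational using (ℚ; 0ℚ; 1ℚ; _+_; _-_; ∣_∣; _≤_)
open import Relation.Binary.PropositionalEquality using (_≡_)
open import Relation.Nullary using (¬_)

data Expands : List ℚ → List ℚ → Set where
  exp-[] : Expands [] []
  exp-next : ∀ {a xs ys} → Expands xs ys → Expands (a ∷ xs) (a ∷ ys)
  exp-more : ∀ {a xs ys} → Expands (a ∷ xs) ys → Expands (a ∷ xs) (a ∷ ys)

-- ℓ1 distance ∑ |a_i - b_i| (used only on equal-length lists)
l1 : List ℚ → List ℚ → ℚ
l1 (a ∷ as) (b ∷ bs) = ∣ a - b ∣ + l1 as bs
l1 _ _ = 0ℚ

ExpPair : List ℚ → List ℚ → List ℚ → List ℚ → Set
ExpPair x y x̄ ȳ = Expands x x̄ × Expands y ȳ × length x̄ ≡ length ȳ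

-- The value 'nothing' stands for +∞ (minimum over the empty set,
-- which happens exactly when one of x, y is empty and the other is not).
data IsDTW (x y : List ℚ) : Maybe ℚ → Set where
  dtw-fin : ∀ {d} →
    (Σ (List ℚ) λ x̄ → Σ (List ℚ) λ ȳ → ExpPair x y x̄ ȳ × l1 x̄ ȳ ≡ d) →
    (∀ x̄ ȳ → ExpPair x y x̄ ȳ → d ≤ l1 x̄ ȳ) →
    IsDTW x y (just d)
  dtw-inf : (∀ x̄ ȳ → ¬ ExpPair x y x̄ ȳ) → IsDTW x y nothing

bit : Bool → ℚ
bit false = 0ℚ
bit true = 1ℚ

bits : List Bool → List ℚ
bits = map bit

{-# OPTIONS --safe #-}
-- Take c = ½. Against a binary sequence every ½ of a query costs exactly ½,
-- whatever it is aligned with, so d(s, ½) = ℓ/2 reveals the length ℓ of s.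
-- For a + b + 1 = ℓ, the probe ½^a 1 ½^b aligned position by position with s
-- costs (ℓ − 1)/2 if s_a = 1. If s_a = 0, every alignment costs at least ℓ/2:
-- either some ½ of the probe is repeated, giving ℓ halves, or the 1 meets a copy
-- of s_a and costs 1 instead of ½. So s_a = 1 iff d(s, ½^a 1 ½^b) < ℓ/2.
module Submission where

open import Defs
open import Data.Nat
  using (ℕ; zero; suc; _*_; _+_; _∸_; _≤_; _<_; _≤′_; ≤′-refl; ≤′-step; z≤n; s≤s; _<?_)
open import Data.Nat.Properties as ℕ using (≤⇒≤′; suc-injective)
open import Data.Fin as Fin using (Fin; toℕ; fromℕ<; cast; combine; remQuot)
open import Data.Fin.Properties
  using (toℕ<n; toℕ-fromℕ<; toℕ-injective; remQuot-combine; combine-remQuot; cast-involutive)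
open import Data.Bool using (Bool; true; false)
open import Data.List using (List; []; _∷_; _++_; length; replicate; lookup; tabulate)
open import Data.List.Properties
  using (length-map; length-replicate; ∷-injectiveʳ; tabulate-cong; tabulate-lookup)
open import Data.List.Relation.Unary.All using (All; []; _∷_)
open import Data.List.Relation.Unary.All.Properties using (++⁺; ++⁻ʳ; replicate⁺)
open import Data.Maybe using (Maybe; just; nothing)
open import Data.Product using (Σ; _×_; _,_; uncurry)
open import Data.Sum using (_⊎_; inj₁; inj₂)
open import Data.Rational using (ℚ; 0ℚ; 1ℚ; ½; ∣_∣)
  renaming (_+_ to _+ℚ_; _-_ to _-ℚ_; _≤_ to _≤ℚ_; _<_ to _<ℚ_)
import Data.Rational.Properties as ℚ
open import Function.Definitions using (Injective)
open import Relation.Binary.Definitions using (tri<; tri≈; tri>)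
open import Relation.Binary.PropositionalEquality
  using (_≡_; _≢_; refl; sym; trans; cong; cong₂; subst; subst₂; module ≡-Reasoning)
open import Relation.Nullary using (¬_; yes; no; does)
open import Relation.Nullary.Decidable using (dec-true; dec-false; toWitness)
open import Data.Empty using (⊥-elim)

halves : ℕ → ℚ
halves zero    = 0ℚ
halves (suc k) = ½ +ℚ halves k

halves-<-suc : ∀ k → halves k <ℚ halves (suc k)
halves-<-suc k =
  subst (_<ℚ halves (suc k)) (ℚ.+-identityˡ (halves k)) (ℚ.+-monoˡ-< (halves k) 0<½)
  where
  0<½ : 0ℚ <ℚ ½
  0<½ = toWitness {a? = 0ℚ ℚ.<? ½} _

halves-mono-≤′ : ∀ {m n} → m ≤′ n → halves m ≤ℚ halves n
halves-mono-≤′ ≤′-refl          = ℚ.≤-refl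
halves-mono-≤′ (≤′-step {n} p) = ℚ.≤-trans (halves-mono-≤′ p) (ℚ.<⇒≤ (halves-<-suc n))

halves-mono-≤ : ∀ {m n} → m ≤ n → halves m ≤ℚ halves n
halves-mono-≤ m≤n = halves-mono-≤′ (≤⇒≤′ m≤n)

halves-mono-< : ∀ {m n} → m < n → halves m <ℚ halves n
halves-mono-< {m} m<n = ℚ.<-≤-trans (halves-<-suc m) (halves-mono-≤ m<n)

halves-injective : Injective _≡_ _≡_ halves
halves-injective {m} {n} eq with ℕ.<-cmp m n
... | tri< m<n _ _ = ⊥-elim (ℚ.<⇒≢ (halves-mono-< m<n) eq)
... | tri≈ _ m≡n _ = m≡n
... | tri> _ _ n<m = ⊥-elim (ℚ.<⇒≢ (halves-mono-< n<m) (sym eq))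

probe : ℕ → ℕ → List ℚ
probe a b = replicate a ½ ++ 1ℚ ∷ replicate b ½

count½ : List ℚ → ℕ
count½ []       = 0
count½ (y ∷ ys) with y ℚ.≟ ½
... | yes _ = suc (count½ ys)
... | no _  = count½ ys

count½-∷-≤ : ∀ y ys → count½ ys ≤ count½ (y ∷ ys)
count½-∷-≤ y ys with y ℚ.≟ ½
... | yes _ = ℕ.n≤1+n _
... | no _  = ℕ.≤-refl

count½-∷-mono : ∀ y {xs ys} → count½ xs ≤ count½ ys → count½ (y ∷ xs) ≤ count½ (y ∷ ys)
count½-∷-mono y le with y ℚ.≟ ½
... | yes _ = s≤s le
... | no _  = le

count½-all : ∀ {ys} → All (_≡ ½) ys → count½ ys ≡ length ys
count½-all []           = refl
count½-all (refl ∷ all) = cong suc (count½-all all)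

count½-replicate : ∀ k → count½ (replicate k ½) ≡ k
count½-replicate k = trans (count½-all (replicate⁺ k refl)) (length-replicate k)

count½-probe : ∀ a b → count½ (probe a b) ≡ a + b
count½-probe zero    b = count½-replicate b
count½-probe (suc a) b = cong suc (count½-probe a b)

Expands-refl : ∀ x → Expands x x
Expands-refl []      = exp-[]
Expands-refl (a ∷ x) = exp-next (Expands-refl x)

Expands-singleton : ∀ (c : ℚ) k → Expands (c ∷ []) (replicate (suc k) c)
Expands-singleton c zero    = exp-next exp-[]
Expands-singleton c (suc k) = exp-more (Expands-singleton c k)

Expands-length-≤ : ∀ {x x̄} → Expands x x̄ → length x ≤ length x̄
Expands-length-≤ exp-[]       = z≤n
Expands-length-≤ (exp-next e) = s≤s (Expands-length-≤ e)
Expands-length-≤ (exp-more e) = ℕ.m≤n⇒m≤1+n (Expands-length-≤ e)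

Expands-count½-≤ : ∀ {y ȳ} → Expands y ȳ → count½ y ≤ count½ ȳ
Expands-count½-≤ exp-[]                     = z≤n
Expands-count½-≤ (exp-next {a} e)           = count½-∷-mono a (Expands-count½-≤ e)
Expands-count½-≤ (exp-more {a} {ys = ys} e) = ℕ.≤-trans (Expands-count½-≤ e) (count½-∷-≤ a ys)

Expands-All : ∀ {P : ℚ → Set} {x x̄} → Expands x x̄ → All P x → All P x̄
Expands-All exp-[]       []         = []
Expands-All (exp-next e) (px ∷ pxs) = px ∷ Expands-All e pxs
Expands-All (exp-more e) (px ∷ pxs) = px ∷ Expands-All e (px ∷ pxs)

∣bit-½∣ : ∀ x → ∣ bit x -ℚ ½ ∣ ≡ ½
∣bit-½∣ false = refl
∣bit-½∣ true  = refl

≤-∣-∣+ : ∀ {L r} u v → L ≤ℚ r → L ≤ℚ ∣ u -ℚ v ∣ +ℚ r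
≤-∣-∣+ {L} {r} u v L≤r = ℚ.≤-trans L≤r
  (subst (_≤ℚ ∣ u -ℚ v ∣ +ℚ r) (ℚ.+-identityˡ r) (ℚ.+-monoˡ-≤ r (ℚ.0≤∣p∣ (u -ℚ v))))

halves-suc-≤-∣bit-½∣+ : ∀ x {k r} → halves k ≤ℚ r → halves (suc k) ≤ℚ ∣ bit x -ℚ ½ ∣ +ℚ r
halves-suc-≤-∣bit-½∣+ x {k} {r} k≤r =
  subst (λ c → ½ +ℚ halves k ≤ℚ c +ℚ r) (sym (∣bit-½∣ x)) (ℚ.+-monoʳ-≤ ½ k≤r)

halves-suc-≤-∣0-1∣+ : ∀ k {r} → halves k ≤ℚ r → halves (suc k) ≤ℚ ∣ bit false -ℚ 1ℚ ∣ +ℚ r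
halves-suc-≤-∣0-1∣+ _ = ℚ.+-mono-≤ (toWitness {a? = ½ ℚ.≤? 1ℚ} _)

length-bits : ∀ s → length (bits s) ≡ length s
length-bits = length-map bit

LowerBound : List ℚ → List ℚ → ℚ → Set
LowerBound x y L = ∀ {x̄ ȳ} → ExpPair x y x̄ ȳ → L ≤ℚ l1 x̄ ȳ

halves-count½-∷-≤ : ∀ x y {ys r} → halves (count½ ys) ≤ℚ r →
                    halves (count½ (y ∷ ys)) ≤ℚ ∣ bit x -ℚ y ∣ +ℚ r
halves-count½-∷-≤ x y {ys} le with y ℚ.≟ ½
... | yes refl = halves-suc-≤-∣bit-½∣+ x {count½ ys} le
... | no _     = ≤-∣-∣+ (bit x) y le

halves-count½≤l1 : ∀ s {x̄ ȳ} → Expands (bits s) x̄ → length x̄ ≡ length ȳ →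
                   halves (count½ ȳ) ≤ℚ l1 x̄ ȳ
halves-count½≤l1 []      {ȳ = []}    exp-[]       _  = ℚ.≤-refl
halves-count½≤l1 (x ∷ s) {ȳ = y ∷ ȳ} (exp-next e) eq =
  halves-count½-∷-≤ x y (halves-count½≤l1 s e (suc-injective eq))
halves-count½≤l1 (x ∷ s) {ȳ = y ∷ ȳ} (exp-more e) eq =
  halves-count½-∷-≤ x y (halves-count½≤l1 (x ∷ s) e (suc-injective eq))

count½-LowerBound : ∀ s {y k} → count½ y ≡ k → LowerBound (bits s) y (halves k)
count½-LowerBound s refl (ex , ey , eq) =
  ℚ.≤-trans (halves-mono-≤ (Expands-count½-≤ ey)) (halves-count½≤l1 s ex eq)

length-LowerBound : ∀ s {y} → All (_≡ ½) y → LowerBound (bits s) y (halves (length s))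
length-LowerBound s all½ {x̄} {ȳ} (ex , ey , eq) =
  ℚ.≤-trans (halves-mono-≤ s≤ȳ) (halves-count½≤l1 s ex eq)
  where
  s≤ȳ : length s ≤ count½ ȳ
  s≤ȳ = subst₂ _≤_ (length-bits s) (trans eq (sym (count½-all (Expands-All ey all½))))
                   (Expands-length-≤ ex)

zeroAtHead-LowerBound : ∀ s b (p : Fin (length s)) → lookup s p ≡ false → toℕ p + b < length s →
                        LowerBound (bits s) (probe 0 b) (halves (suc b))
zeroAtHead-LowerBound (false ∷ s) b Fin.zero refl _ (exp-next ex , exp-next ey , eq) =
  halves-suc-≤-∣0-1∣+ b (count½-LowerBound s (count½-replicate b) (ex , ey , suc-injective eq))
zeroAtHead-LowerBound (false ∷ s) b Fin.zero refl _ (exp-more ex , exp-next ey , eq) =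
  halves-suc-≤-∣0-1∣+ b (count½-LowerBound (false ∷ s) (count½-replicate b) (ex , ey , suc-injective eq))
zeroAtHead-LowerBound (false ∷ s) b Fin.zero refl _ (exp-next ex , exp-more ey , eq) =
  halves-suc-≤-∣0-1∣+ b (count½-LowerBound s (count½-replicate b) (ex , ey , suc-injective eq))
zeroAtHead-LowerBound (false ∷ s) b Fin.zero refl _ (exp-more ex , exp-more ey , eq) =
  halves-suc-≤-∣0-1∣+ b (count½-LowerBound (false ∷ s) (count½-replicate b) (ex , ey , suc-injective eq))
zeroAtHead-LowerBound (x ∷ s) b (Fin.suc p) _ (s≤s p+b<s) (exp-next ex , exp-next ey , eq) =
  ≤-∣-∣+ (bit x) 1ℚ (ℚ.≤-trans (halves-mono-≤ b<s)
    (length-LowerBound s (replicate⁺ b refl) (ex , ey , suc-injective eq)))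
  where
  b<s : b < length s
  b<s = ℕ.≤-<-trans (ℕ.m≤n+m b (toℕ p)) p+b<s
zeroAtHead-LowerBound (x ∷ s) b (Fin.suc p) _ (s≤s p+b<s) (exp-more ex , exp-next ey , eq) =
  ≤-∣-∣+ (bit x) 1ℚ (ℚ.≤-trans (halves-mono-≤ b<s)
    (length-LowerBound (x ∷ s) (replicate⁺ b refl) (ex , ey , suc-injective eq)))
  where
  b<s : b < suc (length s)
  b<s = ℕ.m≤n⇒m≤1+n (ℕ.≤-<-trans (ℕ.m≤n+m b (toℕ p)) p+b<s)
zeroAtHead-LowerBound (x ∷ s) b (Fin.suc p) p≡0 p+b<s (exp-next ex , exp-more ey , eq) =
  ≤-∣-∣+ (bit x) 1ℚ (zeroAtHead-LowerBound s b p p≡0 (ℕ.≤-pred p+b<s) (ex , ey , suc-injective eq))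
zeroAtHead-LowerBound (x ∷ s) b (Fin.suc p) p≡0 p+b<s (exp-more ex , exp-more ey , eq) =
  ≤-∣-∣+ (bit x) 1ℚ (zeroAtHead-LowerBound (x ∷ s) b (Fin.suc p) p≡0 p+b<s (ex , ey , suc-injective eq))

-- The zero may lie beyond position a, since repeating a head of s while the
-- probe advances shifts a but not the zero.
zeroAt-LowerBound : ∀ s a b (p : Fin (length s)) → lookup s p ≡ false →
                    a ≤ toℕ p → toℕ p + b < length s →
                    LowerBound (bits s) (probe a b) (halves (suc (a + b)))
zeroAt-LowerBound s zero b p p≡0 _ p+b<s = zeroAtHead-LowerBound s b p p≡0 p+b<s
zeroAt-LowerBound (x ∷ s) (suc a) b (Fin.suc p) p≡0 (s≤s a≤p) (s≤s p+b<s) (exp-next ex , exp-next ey , eq) =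
  halves-suc-≤-∣bit-½∣+ x {suc (a + b)} (zeroAt-LowerBound s a b p p≡0 a≤p p+b<s (ex , ey , suc-injective eq))
zeroAt-LowerBound (x ∷ s) (suc a) b p p≡0 a≤p p+b<s (exp-more ex , exp-next ey , eq) =
  halves-suc-≤-∣bit-½∣+ x {suc (a + b)}
    (zeroAt-LowerBound (x ∷ s) a b p p≡0 (ℕ.<⇒≤ a≤p) p+b<s (ex , ey , suc-injective eq))
zeroAt-LowerBound (x ∷ s) (suc a) b _ _ _ _ (exp-next ex , exp-more ey , eq) =
  halves-suc-≤-∣bit-½∣+ x {suc (a + b)}
    (count½-LowerBound s (count½-probe (suc a) b) (ex , ey , suc-injective eq))
zeroAt-LowerBound (x ∷ s) (suc a) b _ _ _ _ (exp-more ex , exp-more ey , eq) =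
  halves-suc-≤-∣bit-½∣+ x {suc (a + b)}
    (count½-LowerBound (x ∷ s) (count½-probe (suc a) b) (ex , ey , suc-injective eq))

IsDTW-≤ : ∀ {x y x̄ ȳ w} → ExpPair x y x̄ ȳ → IsDTW x y w →
          Σ ℚ λ d → w ≡ just d × d ≤ℚ l1 x̄ ȳ
IsDTW-≤ pair (dtw-fin _ minimal) = _ , refl , minimal _ _ pair
IsDTW-≤ pair (dtw-inf none)      = ⊥-elim (none _ _ pair)

IsDTW-≥ : ∀ {x y d L} → IsDTW x y (just d) → LowerBound x y L → L ≤ℚ d
IsDTW-≥ {L = L} (dtw-fin (_ , _ , pair , l1≡d) _) bound = subst (L ≤ℚ_) l1≡d (bound pair)

IsDTW-[]-∷ : ∀ {y ys w} → IsDTW [] (y ∷ ys) w → w ≡ nothing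
IsDTW-[]-∷ (dtw-fin (_ , _ , (exp-[] , exp-next _ , ()) , _) _)
IsDTW-[]-∷ (dtw-fin (_ , _ , (exp-[] , exp-more _ , ()) , _) _)
IsDTW-[]-∷ (dtw-inf _) = refl

l1-replicate-½ : ∀ s → l1 (bits s) (replicate (length s) ½) ≡ halves (length s)
l1-replicate-½ []      = refl
l1-replicate-½ (x ∷ s) = cong₂ _+ℚ_ (∣bit-½∣ x) (l1-replicate-½ s)

l1-probe-true : ∀ s (p : Fin (length s)) b → suc (toℕ p + b) ≡ length s → lookup s p ≡ true →
                l1 (bits s) (probe (toℕ p) b) ≡ halves (toℕ p + b)
l1-probe-true (true ∷ s) Fin.zero .(length s) refl refl = trans (ℚ.+-identityˡ _) (l1-replicate-½ s)
l1-probe-true (x ∷ s) (Fin.suc p) b ℓ≡s p≡1 =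
  cong₂ _+ℚ_ (∣bit-½∣ x) (l1-probe-true s p b (suc-injective ℓ≡s) p≡1)

length-probe : ∀ a b → length (probe a b) ≡ suc (a + b)
length-probe zero    b = cong suc (length-replicate b)
length-probe (suc a) b = cong suc (length-probe a b)

IsDTW-bits-½ : ∀ x s {w} → IsDTW (bits (x ∷ s)) (½ ∷ []) w → w ≡ just (halves (suc (length s)))
IsDTW-bits-½ x s dtw with IsDTW-≤ pair dtw
  where
  pair : ExpPair (bits (x ∷ s)) (½ ∷ []) (bits (x ∷ s)) (replicate (suc (length s)) ½)
  pair = Expands-refl _ , Expands-singleton ½ (length s) ,
         trans (length-bits (x ∷ s)) (sym (length-replicate (suc (length s))))
... | d , refl , d≤l1 = cong just (ℚ.≤-antisym
  (subst (d ≤ℚ_) (l1-replicate-½ (x ∷ s)) d≤l1)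
  (IsDTW-≥ dtw (length-LowerBound (x ∷ s) (refl ∷ []))))

findHalves : ℚ → ℕ → ℕ
findHalves d zero    = 0
findHalves d (suc k) with d ℚ.≟ halves (suc k)
... | yes _ = suc k
... | no _  = findHalves d k

findHalves-halves : ∀ {ℓ k} → ℓ ≤ k → findHalves (halves ℓ) k ≡ ℓ
findHalves-halves {k = zero}    z≤n = refl
findHalves-halves {ℓ} {suc k} ℓ≤k with halves ℓ ℚ.≟ halves (suc k)
... | yes ℓ≡k = sym (halves-injective ℓ≡k)
... | no  ℓ≢k =
  findHalves-halves (ℕ.≤-pred (ℕ.≤∧≢⇒< ℓ≤k (λ ℓ≡k → ℓ≢k (cong halves ℓ≡k))))

decodeLength : ℕ → Maybe ℚ → ℕ
decodeLength n nothing  = 0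
decodeLength n (just d) = findHalves d n

decodeLength-correct : ∀ {n w} s → length s ≤ n → IsDTW (bits s) (½ ∷ []) w →
                       decodeLength n w ≡ length s
decodeLength-correct []      _   dtw rewrite IsDTW-[]-∷ dtw = refl
decodeLength-correct (x ∷ s) s≤n dtw rewrite IsDTW-bits-½ x s dtw = findHalves-halves s≤n

decodeBit : ℕ → Maybe ℚ → Bool
decodeBit ℓ nothing  = false
decodeBit ℓ (just d) = does (d ℚ.<? halves ℓ)

decodeBit-correct : ∀ {w} s (p : Fin (length s)) b → suc (toℕ p + b) ≡ length s →
                    IsDTW (bits s) (probe (toℕ p) b) w → decodeBit (length s) w ≡ lookup s p
decodeBit-correct s p b ℓ≡s dtw with IsDTW-≤ aligned dtw | lookup s p in bitₚ
  where
  aligned : ExpPair (bits s) (probe (toℕ p) b) (bits s) (probe (toℕ p) b)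
  aligned = Expands-refl _ , Expands-refl _ ,
            trans (length-bits s) (trans (sym ℓ≡s) (sym (length-probe (toℕ p) b)))
... | d , refl , d≤l1 | true = dec-true (d ℚ.<? halves (length s)) (ℚ.≤-<-trans d≤ℓ-1 ℓ-1<ℓ)
  where
  d≤ℓ-1 : d ≤ℚ halves (toℕ p + b)
  d≤ℓ-1 = subst (d ≤ℚ_) (l1-probe-true s p b ℓ≡s bitₚ) d≤l1
  ℓ-1<ℓ : halves (toℕ p + b) <ℚ halves (length s)
  ℓ-1<ℓ = subst (λ ℓ → halves (toℕ p + b) <ℚ halves ℓ) ℓ≡s (halves-<-suc (toℕ p + b))
... | d , refl , _ | false =
  dec-false (d ℚ.<? halves (length s)) (λ d<ℓ → ℚ.<-irrefl refl (ℚ.≤-<-trans ℓ≤d d<ℓ))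
  where
  ℓ≤d : halves (length s) ≤ℚ d
  ℓ≤d = subst (λ ℓ → halves ℓ ≤ℚ d) ℓ≡s
          (IsDTW-≥ dtw (zeroAt-LowerBound s (toℕ p) b p bitₚ ℕ.≤-refl (ℕ.≤-reflexive ℓ≡s)))

decodeBits : ℕ → (ℕ → ℕ → Maybe ℚ) → List Bool
decodeBits ℓ probeAnswer =
  tabulate {n = ℓ} λ i → decodeBit ℓ (probeAnswer (toℕ i) (ℓ ∸ suc (toℕ i)))

decode : ℕ → Maybe ℚ → (ℕ → ℕ → Maybe ℚ) → List Bool
decode n lengthAnswer probeAnswer = decodeBits (decodeLength n lengthAnswer) probeAnswer

decode-correct : ∀ {n lengthAnswer probeAnswer} s → length s ≤ n →
                 IsDTW (bits s) (½ ∷ []) lengthAnswer →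
                 (∀ a b → suc (a + b) ≡ length s → IsDTW (bits s) (probe a b) (probeAnswer a b)) →
                 decode n lengthAnswer probeAnswer ≡ s
decode-correct {n} {lengthAnswer} {probeAnswer} s s≤n lengthDTW probeDTW = begin
  decodeBits (decodeLength n lengthAnswer) probeAnswer
    ≡⟨ cong (λ ℓ → decodeBits ℓ probeAnswer) (decodeLength-correct s s≤n lengthDTW) ⟩
  decodeBits (length s) probeAnswer
    ≡⟨ tabulate-cong (λ i → decodeBit-correct s i _ (ℓ≡s i) (probeDTW _ _ (ℓ≡s i))) ⟩
  tabulate (lookup s)
    ≡⟨ tabulate-lookup s ⟩
  s ∎
  where
  open ≡-Reasoning
  ℓ≡s : (i : Fin (length s)) → suc (toℕ i + (length s ∸ suc (toℕ i))) ≡ length s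
  ℓ≡s i = ℕ.m+[n∸m]≡n (toℕ<n i)

-- Of the runs ½^(a+1) only ½ itself is ever consulted; the others fill up the index set.
query : ∀ {n} → Fin n → Fin (suc n) → List ℚ
query a Fin.zero    = replicate (suc (toℕ a)) ½
query a (Fin.suc b) = probe (toℕ a) (toℕ b)

probe-injective : ∀ {a b a′ b′} → probe a b ≡ probe a′ b′ → a ≡ a′ × b ≡ b′
probe-injective {zero}  {b} {zero}  {b′} eq =
  refl , trans (sym (length-replicate b)) (trans (cong length (∷-injectiveʳ eq)) (length-replicate b′))
probe-injective {suc a} {b} {suc a′} {b′} eq with probe-injective {a} {b} {a′} {b′} (∷-injectiveʳ eq)
... | a≡a′ , b≡b′ = cong suc a≡a′ , b≡b′

probe-not-½s : ∀ a b → ¬ All (_≡ ½) (probe a b)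
probe-not-½s a b all½ with ++⁻ʳ (replicate a ½) all½
... | () ∷ _

query-injective : ∀ {n} → Injective _≡_ _≡_ (uncurry (query {n}))
query-injective {x = a , Fin.zero} {a′ , Fin.zero} eq =
  cong (_, Fin.zero) (toℕ-injective (suc-injective (begin
    suc (toℕ a)                      ≡⟨ length-replicate (suc (toℕ a)) ⟨
    length (replicate (suc (toℕ a)) ½)  ≡⟨ cong length eq ⟩
    length (replicate (suc (toℕ a′)) ½) ≡⟨ length-replicate (suc (toℕ a′)) ⟩
    suc (toℕ a′)                     ∎)))
  where open ≡-Reasoning
query-injective {x = a , Fin.zero} {a′ , Fin.suc b′} eq =
  ⊥-elim (probe-not-½s (toℕ a′) (toℕ b′) (subst (All (_≡ ½)) eq (replicate⁺ (suc (toℕ a)) refl)))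
query-injective {x = a , Fin.suc b} {a′ , Fin.zero} eq =
  ⊥-elim (probe-not-½s (toℕ a) (toℕ b) (subst (All (_≡ ½)) (sym eq) (replicate⁺ (suc (toℕ a′)) refl)))
query-injective {x = a , Fin.suc b} {a′ , Fin.suc b′} eq with probe-injective eq
... | a≡a′ , b≡b′ = cong₂ _,_ (toℕ-injective a≡a′) (cong Fin.suc (toℕ-injective b≡b′))

query-alphabet : ∀ {n} (a : Fin n) j → All (λ c → c ≡ 0ℚ ⊎ c ≡ 1ℚ ⊎ c ≡ ½) (query a j)
query-alphabet a Fin.zero    = replicate⁺ (suc (toℕ a)) (inj₂ (inj₂ refl))
query-alphabet a (Fin.suc b) =
  ++⁺ (replicate⁺ (toℕ a) (inj₂ (inj₂ refl)))
      (inj₂ (inj₁ refl) ∷ replicate⁺ (toℕ b) (inj₂ (inj₂ refl)))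

module _ {n : ℕ} where

  private
    n*[1+n]≡n*n+n : n * suc n ≡ n * n + n
    n*[1+n]≡n*n+n = trans (ℕ.*-suc n n) (ℕ.+-comm n (n * n))

  pair : Fin n → Fin (suc n) → Fin (n * n + n)
  pair a j = cast n*[1+n]≡n*n+n (combine a j)

  unpair : Fin (n * n + n) → Fin n × Fin (suc n)
  unpair i = remQuot (suc n) (cast (sym n*[1+n]≡n*n+n) i)

  unpair-pair : ∀ a j → unpair (pair a j) ≡ (a , j)
  unpair-pair a j =
    trans (cong (remQuot (suc n)) (cast-involutive (sym n*[1+n]≡n*n+n) n*[1+n]≡n*n+n (combine a j)))
          (remQuot-combine a j)

  unpair-injective : Injective _≡_ _≡_ unpair
  unpair-injective {i} {i′} eq = begin
    i                                  ≡⟨ cast-involutive e (sym e) i ⟨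
    cast e (cast (sym e) i)            ≡⟨ cong (cast e) (combine-remQuot {n} (suc n) _) ⟨
    cast e (uncurry combine (unpair i))  ≡⟨ cong (λ aj → cast e (uncurry combine aj)) eq ⟩
    cast e (uncurry combine (unpair i′)) ≡⟨ cong (cast e) (combine-remQuot {n} (suc n) _) ⟩
    cast e (cast (sym e) i′)           ≡⟨ cast-involutive e (sym e) i′ ⟩
    i′                                 ∎
    where
    open ≡-Reasoning
    e : n * suc n ≡ n * n + n
    e = n*[1+n]≡n*n+n

probeAnswers : ∀ {n} → (Fin n → Fin (suc n) → Maybe ℚ) → ℕ → ℕ → Maybe ℚ
probeAnswers {n} answer a b with a <? n | b <? n
... | yes a<n | yes b<n = answer (fromℕ< a<n) (Fin.suc (fromℕ< b<n))
... | _       | _       = nothing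

probeAnswers-IsDTW : ∀ {n x} {answer : Fin n → Fin (suc n) → Maybe ℚ} →
                     (∀ a j → IsDTW x (query a j) (answer a j)) →
                     ∀ {a b} → a + b < n → IsDTW x (probe a b) (probeAnswers answer a b)
probeAnswers-IsDTW {n} {x} {answer} dtw {a} {b} a+b<n with a <? n | b <? n
... | yes a<n | yes b<n =
  subst (λ y → IsDTW x y (answer a′ (Fin.suc b′))) (cong₂ probe (toℕ-fromℕ< a<n) (toℕ-fromℕ< b<n))
        (dtw a′ (Fin.suc b′))
  where
  a′ b′ : Fin n
  a′ = fromℕ< a<n
  b′ = fromℕ< b<n
... | no a≮n  | _      = ⊥-elim (a≮n (ℕ.≤-<-trans (ℕ.m≤m+n a b) a+b<n))
... | yes _   | no b≮n = ⊥-elim (b≮n (ℕ.≤-<-trans (ℕ.m≤n+m b a) a+b<n))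

mainTheorem13 : (n : ℕ) → 1 ≤ n →
    Σ ℚ λ c → c ≢ 0ℚ × c ≢ 1ℚ ×
    Σ (Fin (n * n + n) → List ℚ) λ Q →
      Injective _≡_ _≡_ Q ×
      (∀ i → All (λ a → a ≡ 0ℚ ⊎ a ≡ 1ℚ ⊎ a ≡ c) (Q i)) ×
      Σ ((Fin (n * n + n) → Maybe ℚ) → List Bool) λ A →
        ∀ (s : List Bool) → length s ≤ n →
        (v : Fin (n * n + n) → Maybe ℚ) →
        (∀ i → IsDTW (bits s) (Q i) (v i)) →
        A v ≡ s
mainTheorem13 n@(suc _) _ =
  ½ , (λ ()) , (λ ()) , Q , (λ eq → unpair-injective {n} (query-injective eq)) ,
  (λ i → uncurry query-alphabet (unpair {n} i)) , A , correct
  where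
  Q : Fin (n * n + n) → List ℚ
  Q i = uncurry query (unpair {n} i)
  A : (Fin (n * n + n) → Maybe ℚ) → List Bool
  A v = decode n (v (pair {n} Fin.zero Fin.zero)) (probeAnswers {n} (λ a j → v (pair a j)))
  correct : ∀ s → length s ≤ n → (v : Fin (n * n + n) → Maybe ℚ) →
            (∀ i → IsDTW (bits s) (Q i) (v i)) → A v ≡ s
  correct s s≤n v dtw = decode-correct s s≤n (answers Fin.zero Fin.zero)
    (λ a b ℓ≡s → probeAnswers-IsDTW answers (subst (_≤ n) (sym ℓ≡s) s≤n))
    where
    answers : ∀ (a : Fin n) j → IsDTW (bits s) (query a j) (v (pair a j))
    answers a j = subst (λ y → IsDTW (bits s) y (v (pair a j)))
                        (cong (uncurry query) (unpair-pair a j)) (dtw (pair a j))
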